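{- Let $n\ge 1$, $1\le i\le n$ and $k\ge 1$ be integers, with the convention $\binom{a}{b}=0$ if $b<0$ or $b>a$. For $1\le r,s\le n$ put \[ b^{(1)}_{r,s}=\frac{1}{2^{r-1}}\binom{r-1}{s-1},\qquad b^{(2)}_{r,s}=\frac{1}{2^{n-r}}\binom{n-r}{s-r}. \] For a list $L=[L[1],\dots,L[k]]$ with entries in $\{1,2\}$ define \[ p_L(j)=\sum_{s_1=1}^n\cdots\sum_{s_{k-1}=1}^n b^{(L[1])}_{i,s_1}b^{(L[2])}_{s_1,s_2}\cdots b^{(L[k])}_{s_{k-1},j},\qquad j=1,\dots,n \] (for $k=1$ this is $p_L(j)=b^{(L[1])}_{i,j}$), and its generating function $F_L(x)=\sum_{j=1}^n p_L(j)\,x^j$. Index the $2^k$ lists as $L_1,\dots,L_{2^k}$, where $L_t$ is the unique list with $t=1+\sum_{m=1}^{k}(L_t[m]-1)\,2^{m-1}$. Let \[ g(a,b)=[ax+(1-a)]^{n-i}\,[bx+(1-b)]^{i-1}\,x. \] Then for every $t=1,2,\dots,2^k$, \[ F_{L_t}(x)=g\!\left(\frac{t-1}{2^k},\frac{t}{2^k}\right). \]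
   Context: This arises from riffle shuffling a deck of $n$ cards: the one-shuffle probability that position $i$ holds card $j$ is $a(i,j,n)=\frac12\big(b^{(1)}_{i,j}+b^{(2)}_{i,j}\big)$, and the $k$-shuffle probability $a^{(k)}_{i,j}$ (entries of the $k$-th power of the matrix $(a(i,j,n))_{i,j}$) equals $2^{ -k}\sum_{L}p_L(j)$. The indexing of lists by $t$ is the one obtained by repeatedly prepending an entry: if $L'$ has index $t'$ among lists of length $k-1$, then $[1,L']$ has index $2t'-1$ and $[2,L']$ has index $2t'$. -}

module Defs where

open import Data.Nat as ℕ using (ℕ; zero; suc; _∸_; _<ᵇ_)
open import Data.Nat.Combinatorics using (_C_)
open import Data.Integer using (+_)
open import Data.Rational using (ℚ; _+_; _*_; _-_; _/_; ½; 0ℚ; 1ℚ)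
open import Data.Fin using (Fin; zero; suc; toℕ)
open import Data.Vec using (Vec; []; _∷_)
open import Data.Bool using (if_then_else_)

ℕ→ℚ : ℕ → ℚ
ℕ→ℚ m = (+ m) / 1

_^ℚ_ : ℚ → ℕ → ℚ
q ^ℚ zero = 1ℚ
q ^ℚ suc m = q * (q ^ℚ m)

-- binomial with the convention C(a,b) = 0 for b < 0 or b > a;
-- here the "lower index" is given as the integer difference u - v with u, v : ℕ
binom : ℕ → ℕ → ℕ → ℕ
binom a u v = if u <ᵇ v then 0 else a C (u ∸ v)

sum1to : ℕ → (ℕ → ℚ) → ℚ
sum1to zero f = 0ℚ
sum1to (suc m) f = sum1to m f + f (suc m)

b1 : ℕ → ℕ → ℚ
b1 r s = (½ ^ℚ (r ∸ 1)) * ℕ→ℚ (binom (r ∸ 1) s 1)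

b2 : ℕ → ℕ → ℕ → ℚ
b2 n r s = (½ ^ℚ (n ∸ r)) * ℕ→ℚ (binom (n ∸ r) s r)

-- list entries in {1,2} are represented by Fin 2: zero ↦ 1, suc zero ↦ 2
entry : Fin 2 → ℕ
entry c = suc (toℕ c)

bsel : ℕ → Fin 2 → ℕ → ℕ → ℚ
bsel n zero r s = b1 r s
bsel n (suc zero) r s = b2 n r s

chain : (n : ℕ) {k : ℕ} → Vec (Fin 2) (suc k) → ℕ → ℕ → ℚ
chain n (c ∷ []) r j = bsel n c r j
chain n (c ∷ (d ∷ L)) r j = sum1to n (λ s → bsel n c r s * chain n (d ∷ L) s j)

p : (n i : ℕ) {k : ℕ} → Vec (Fin 2) (suc k) → ℕ → ℚ
p n i L j = chain n L i j

F : (n i : ℕ) {k : ℕ} → Vec (Fin 2) (suc k) → ℚ → ℚ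
F n i L x = sum1to n (λ j → p n i L j * (x ^ℚ j))

idx0 : {k : ℕ} → Vec (Fin 2) k → ℕ
idx0 [] = 0
idx0 (c ∷ L) = toℕ c ℕ.+ 2 ℕ.* idx0 L

index : {k : ℕ} → Vec (Fin 2) k → ℕ
index L = suc (idx0 L)

g : (n i : ℕ) → ℚ → ℚ → ℚ → ℚ
g n i a b x = (((a * x + (1ℚ - a)) ^ℚ (n ∸ i)) * ((b * x + (1ℚ - b)) ^ℚ (i ∸ 1))) * x

-- Write A_a = a x + (1 − a), the generating function of a Bernoulli(a) variable, so that
-- g(a, b) = A_a^{n−i} A_b^{i−1} x. Summing a row of b^{(1)} (resp. b^{(2)}) against the
-- polynomials g(a, b) taken at the row indices s is, by the binomial theorem, the same as
-- replacing b (resp. a) by the midpoint (a + b)/2, because 2^{−m} (A_a + A_b)^m = A_{(a+b)/2}^m.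
-- Expanding the chain product from the left, each entry of L therefore halves the interval
-- [a, b], starting from [0, 1] (where g(0, 1) at index j is x^j); the entry 1 keeps the lower
-- half and 2 the upper half, and after k steps one is left with [(t−1)/2^k, t/2^k].
module Submission where

open import Defs
open import Data.Nat using (ℕ; suc; _≤_; _∸_)
open import Data.Rational using (ℚ; _*_; ½)
open import Data.Fin using (Fin)
open import Data.Vec using (Vec)
open import Relation.Binary.PropositionalEquality using (_≡_)

open import Data.Nat as ℕ using (zero; z≤n; s≤s)
import Data.Nat.Properties as ℕ
open import Data.Nat.Combinatorics using (_C_; nCk+nC[k+1]≡[n+1]C[k+1])
import Data.Integer as ℤ
import Data.Integer.Properties as ℤ
open import Data.Rational using (_+_; _-_; 0ℚ; 1ℚ)
open import Data.Rational.Properties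
  using (normalize-coprime; /-cong; *-zeroˡ; *-zeroʳ; *-identityˡ; *-identityʳ; *-comm; *-assoc;
         *-distribˡ-+; *-distribʳ-+; +-identityˡ; +-identityʳ; +-assoc)
open import Data.Rational.Solver using (module +-*-Solver)
open import Data.Nat.Coprimality using (1-coprimeTo) renaming (sym to coprime-sym)
open import Data.Fin using (zero; suc)
open import Data.Vec using ([]; _∷_)
open import Data.Empty using (⊥-elim)
open import Function using (_∘_)
open import Relation.Nullary using (yes; no)
open import Relation.Binary.PropositionalEquality using (_≢_; refl; sym; trans; cong; cong₂; module ≡-Reasoning)
open +-*-Solver
open ≡-Reasoning

ℕ→ℚ-suc : ∀ m → ℕ→ℚ (suc m) ≡ 1ℚ + ℕ→ℚ m
ℕ→ℚ-suc m
  rewrite normalize-coprime {m} {0} (coprime-sym (1-coprimeTo m))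
  = /-cong (cong (ℤ._+_ (ℤ.+ 1)) (sym (ℤ.*-identityʳ (ℤ.+ m)))) refl

ℕ→ℚ-+ : ∀ a b → ℕ→ℚ (a ℕ.+ b) ≡ ℕ→ℚ a + ℕ→ℚ b
ℕ→ℚ-+ zero    b = sym (+-identityˡ (ℕ→ℚ b))
ℕ→ℚ-+ (suc a) b = begin
  ℕ→ℚ (suc (a ℕ.+ b))         ≡⟨ ℕ→ℚ-suc (a ℕ.+ b) ⟩
  1ℚ + ℕ→ℚ (a ℕ.+ b)          ≡⟨ cong (1ℚ +_) (ℕ→ℚ-+ a b) ⟩
  1ℚ + (ℕ→ℚ a + ℕ→ℚ b)        ≡⟨ sym (+-assoc 1ℚ (ℕ→ℚ a) (ℕ→ℚ b)) ⟩
  (1ℚ + ℕ→ℚ a) + ℕ→ℚ b        ≡⟨ cong (_+ ℕ→ℚ b) (sym (ℕ→ℚ-suc a)) ⟩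
  ℕ→ℚ (suc a) + ℕ→ℚ b         ∎

ℕ→ℚ-double : ∀ a → ℕ→ℚ (2 ℕ.* a) ≡ ℕ→ℚ a + ℕ→ℚ a
ℕ→ℚ-double a = trans (cong (λ b → ℕ→ℚ (a ℕ.+ b)) (ℕ.+-identityʳ a)) (ℕ→ℚ-+ a a)

sum1to-cong : ∀ n (f h : ℕ → ℚ) → (∀ s → 1 ≤ s → s ≤ n → f s ≡ h s) → sum1to n f ≡ sum1to n h
sum1to-cong zero    f h f≡h = refl
sum1to-cong (suc n) f h f≡h =
  cong₂ _+_ (sum1to-cong n f h (λ s 1≤s s≤n → f≡h s 1≤s (ℕ.m≤n⇒m≤1+n s≤n))) (f≡h (suc n) (s≤s z≤n) ℕ.≤-refl)

sum1to-0 : ∀ n → sum1to n (λ _ → 0ℚ) ≡ 0ℚ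
sum1to-0 zero = refl
sum1to-0 (suc n) rewrite sum1to-0 n = refl

sum1to-zero : ∀ n (f : ℕ → ℚ) → (∀ s → 1 ≤ s → s ≤ n → f s ≡ 0ℚ) → sum1to n f ≡ 0ℚ
sum1to-zero n f f≡0 = trans (sum1to-cong n f (λ _ → 0ℚ) f≡0) (sum1to-0 n)

sum1to-single : ∀ n (f : ℕ → ℚ) q → 1 ≤ q → q ≤ n → (∀ s → s ≢ q → f s ≡ 0ℚ) → sum1to n f ≡ f q
sum1to-single zero    f zero () z≤n _
sum1to-single (suc n) f q 1≤q q≤1+n off with q ℕ.≟ suc n
... | yes refl =
  trans (cong (_+ f q) (sum1to-zero n f (λ s _ s≤n → off s λ { refl → ℕ.n≮n n s≤n })))
        (+-identityˡ (f q))
... | no q≢1+n =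
  trans (cong₂ _+_ (sum1to-single n f q 1≤q (ℕ.≤-pred (ℕ.≤∧≢⇒< q≤1+n q≢1+n)) off) (off (suc n) (q≢1+n ∘ sym)))
        (+-identityʳ (f q))

sum1to-+ : ∀ n (f h : ℕ → ℚ) → sum1to n (λ s → f s + h s) ≡ sum1to n f + sum1to n h
sum1to-+ zero    f h = refl
sum1to-+ (suc n) f h = trans (cong (_+ (f (suc n) + h (suc n))) (sum1to-+ n f h))
  (solve 4 (λ a b c d → (a :+ b) :+ (c :+ d) := (a :+ c) :+ (b :+ d)) refl
    (sum1to n f) (sum1to n h) (f (suc n)) (h (suc n)))

sum1to-*ˡ : ∀ n c (f : ℕ → ℚ) → sum1to n (λ s → c * f s) ≡ c * sum1to n f
sum1to-*ˡ zero    c f = sym (*-zeroʳ c)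
sum1to-*ˡ (suc n) c f =
  trans (cong (_+ (c * f (suc n))) (sum1to-*ˡ n c f)) (sym (*-distribˡ-+ c (sum1to n f) (f (suc n))))

sum1to-*ʳ : ∀ n c (f : ℕ → ℚ) → sum1to n (λ s → f s * c) ≡ sum1to n f * c
sum1to-*ʳ zero    c f = sym (*-zeroˡ c)
sum1to-*ʳ (suc n) c f =
  trans (cong (_+ (f (suc n) * c)) (sum1to-*ʳ n c f)) (sym (*-distribʳ-+ c (sum1to n f) (f (suc n))))

sum1to-comm : ∀ n m (f : ℕ → ℕ → ℚ) →
  sum1to n (λ j → sum1to m (λ s → f s j)) ≡ sum1to m (λ s → sum1to n (λ j → f s j))
sum1to-comm zero    m f = sym (sum1to-0 m)
sum1to-comm (suc n) m f = trans (cong (_+ sum1to m (λ s → f s (suc n))) (sum1to-comm n m f))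
  (sym (sum1to-+ m (λ s → sum1to n (λ j → f s j)) (λ s → f s (suc n))))

^ℚ-distribʳ-* : ∀ u v k → (u * v) ^ℚ k ≡ (u ^ℚ k) * (v ^ℚ k)
^ℚ-distribʳ-* u v zero    = refl
^ℚ-distribʳ-* u v (suc k) = trans (cong ((u * v) *_) (^ℚ-distribʳ-* u v k))
  (solve 4 (λ u v p q → (u :* v) :* (p :* q) := (u :* p) :* (v :* q)) refl u v (u ^ℚ k) (v ^ℚ k))

1^ℚ : ∀ k → 1ℚ ^ℚ k ≡ 1ℚ
1^ℚ zero = refl
1^ℚ (suc k) rewrite 1^ℚ k = refl

binom-pascal : ∀ m s q → binom (suc m) s q ≡ binom m s q ℕ.+ binom m s (suc q)
binom-pascal m zero    zero    = refl
binom-pascal m (suc s) zero    = trans (sym (nCk+nC[k+1]≡[n+1]C[k+1] m s)) (ℕ.+-comm (m C s) _)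
binom-pascal m zero    (suc q) = refl
binom-pascal m (suc s) (suc q) = binom-pascal m s q

binom-0-diag : ∀ q → binom 0 q q ≡ 1
binom-0-diag zero    = refl
binom-0-diag (suc q) = binom-0-diag q

binom-0-off : ∀ s q → s ≢ q → binom 0 s q ≡ 0
binom-0-off zero    zero    s≢q = ⊥-elim (s≢q refl)
binom-0-off zero    (suc q) _   = refl
binom-0-off (suc s) zero    _   = refl
binom-0-off (suc s) (suc q) s≢q = binom-0-off s q (s≢q ∘ cong suc)

module _ (A B : ℚ) where

  -- binom m s (suc p) is C(m, s − 1 − p): only s = p + 1, …, p + 1 + m contribute.
  binomialTerm : (m p n s : ℕ) → ℚ
  binomialTerm m p n s = ℕ→ℚ (binom m s (suc p)) * ((A ^ℚ (n ∸ s)) * (B ^ℚ (s ∸ 1)))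

  binomial-theorem-shifted : ∀ m p d n → n ≡ suc (p ℕ.+ m) ℕ.+ d →
    sum1to n (binomialTerm m p n) ≡ ((A ^ℚ d) * (B ^ℚ p)) * ((A + B) ^ℚ m)
  binomial-theorem-shifted zero p d n refl = begin
    sum1to n (binomialTerm 0 p n)  ≡⟨ sum1to-single n (binomialTerm 0 p n) (suc p) (s≤s z≤n) 1+p≤n off ⟩
    binomialTerm 0 p n (suc p)     ≡⟨ cong₂ (λ c e → ℕ→ℚ c * ((A ^ℚ e) * (B ^ℚ p))) (binom-0-diag (suc p)) n∸[1+p]≡d ⟩
    1ℚ * ((A ^ℚ d) * (B ^ℚ p))     ≡⟨ trans (*-identityˡ ((A ^ℚ d) * (B ^ℚ p))) (sym (*-identityʳ ((A ^ℚ d) * (B ^ℚ p)))) ⟩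
    ((A ^ℚ d) * (B ^ℚ p)) * 1ℚ     ∎
    where
    1+p≤n : suc p ≤ n
    1+p≤n = ℕ.≤-trans (s≤s (ℕ.≤-reflexive (sym (ℕ.+-identityʳ p)))) (ℕ.m≤m+n _ d)
    n∸[1+p]≡d : n ∸ suc p ≡ d
    n∸[1+p]≡d = trans (cong (λ k → k ℕ.+ d ∸ p) (ℕ.+-identityʳ p)) (ℕ.m+n∸m≡n p d)
    off : ∀ s → s ≢ suc p → binomialTerm 0 p n s ≡ 0ℚ
    off s s≢1+p = trans (cong (λ c → ℕ→ℚ c * ((A ^ℚ (n ∸ s)) * (B ^ℚ (s ∸ 1)))) (binom-0-off s (suc p) s≢1+p))
                        (*-zeroˡ ((A ^ℚ (n ∸ s)) * (B ^ℚ (s ∸ 1))))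
  binomial-theorem-shifted (suc m) p d n n≡ = begin
    sum1to n (binomialTerm (suc m) p n)
      ≡⟨ sum1to-cong n _ _ (λ s _ _ → pascal s) ⟩
    sum1to n (λ s → binomialTerm m p n s + binomialTerm m (suc p) n s)
      ≡⟨ sum1to-+ n _ _ ⟩
    sum1to n (binomialTerm m p n) + sum1to n (binomialTerm m (suc p) n)
      ≡⟨ cong₂ _+_ (binomial-theorem-shifted m p (suc d) n n≡₁) (binomial-theorem-shifted m (suc p) d n n≡₂) ⟩
    ((A ^ℚ suc d) * (B ^ℚ p)) * ((A + B) ^ℚ m) + ((A ^ℚ d) * (B ^ℚ suc p)) * ((A + B) ^ℚ m)
      ≡⟨ solve 5 (λ a b x y z → (a :* x) :* y :* z :+ x :* (b :* y) :* z := x :* y :* ((a :+ b) :* z))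
               refl A B (A ^ℚ d) (B ^ℚ p) ((A + B) ^ℚ m) ⟩
    ((A ^ℚ d) * (B ^ℚ p)) * ((A + B) ^ℚ suc m)
      ∎
    where
    n≡₁ : n ≡ suc (p ℕ.+ m) ℕ.+ suc d
    n≡₁ = trans n≡ (trans (cong (λ k → suc k ℕ.+ d) (ℕ.+-suc p m)) (sym (ℕ.+-suc (suc (p ℕ.+ m)) d)))
    n≡₂ : n ≡ suc (suc p ℕ.+ m) ℕ.+ d
    n≡₂ = trans n≡ (cong (λ k → suc k ℕ.+ d) (ℕ.+-suc p m))
    pascal : ∀ s → binomialTerm (suc m) p n s ≡ binomialTerm m p n s + binomialTerm m (suc p) n s
    pascal s = begin
      ℕ→ℚ (binom (suc m) s (suc p)) * w
        ≡⟨ cong (λ c → ℕ→ℚ c * w) (binom-pascal m s (suc p)) ⟩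
      ℕ→ℚ (binom m s (suc p) ℕ.+ binom m s (suc (suc p))) * w
        ≡⟨ cong (_* w) (ℕ→ℚ-+ (binom m s (suc p)) (binom m s (suc (suc p)))) ⟩
      (ℕ→ℚ (binom m s (suc p)) + ℕ→ℚ (binom m s (suc (suc p)))) * w
        ≡⟨ *-distribʳ-+ w (ℕ→ℚ (binom m s (suc p))) (ℕ→ℚ (binom m s (suc (suc p)))) ⟩
      binomialTerm m p n s + binomialTerm m (suc p) n s
        ∎
      where w = (A ^ℚ (n ∸ s)) * (B ^ℚ (s ∸ 1))

bernoulli : ℚ → ℚ → ℚ
bernoulli a x = a * x + (1ℚ - a)

bernoulli-midpoint : ∀ a b x → bernoulli ((a + b) * ½) x ≡ (bernoulli a x + bernoulli b x) * ½
bernoulli-midpoint = solve 3 (λ a b x →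
  ((a :+ b) :* con ½) :* x :+ (con 1ℚ :- (a :+ b) :* con ½)
    := ((a :* x :+ (con 1ℚ :- a)) :+ (b :* x :+ (con 1ℚ :- b))) :* con ½) refl

^ℚ≡g[0,1] : ∀ n j x → 1 ≤ j → x ^ℚ j ≡ g n j 0ℚ 1ℚ x
^ℚ≡g[0,1] n (suc j) x _ = begin
  x * (x ^ℚ j)                                          ≡⟨ solve 2 (λ x q → x :* q := (con 1ℚ :* q) :* x) refl x (x ^ℚ j) ⟩
  (1ℚ * (x ^ℚ j)) * x                                   ≡⟨ cong₂ (λ u v → (u * v) * x) 1≡ xʲ≡ ⟩
  ((bernoulli 0ℚ x ^ℚ (n ∸ suc j)) * (bernoulli 1ℚ x ^ℚ j)) * x ∎
  where
  1≡ : 1ℚ ≡ bernoulli 0ℚ x ^ℚ (n ∸ suc j)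
  1≡ = trans (sym (1^ℚ (n ∸ suc j)))
             (cong (_^ℚ (n ∸ suc j)) (solve 1 (λ x → con 1ℚ := con 0ℚ :* x :+ (con 1ℚ :- con 0ℚ)) refl x))
  xʲ≡ : x ^ℚ j ≡ bernoulli 1ℚ x ^ℚ j
  xʲ≡ = cong (_^ℚ j) (solve 1 (λ x → x := con 1ℚ :* x :+ (con 1ℚ :- con 1ℚ)) refl x)

row-sum : ∀ n m p d a b x → n ≡ suc (p ℕ.+ m) ℕ.+ d →
  sum1to n (λ s → ((½ ^ℚ m) * ℕ→ℚ (binom m s (suc p))) * g n s a b x)
    ≡ (((bernoulli a x ^ℚ d) * (bernoulli b x ^ℚ p)) * (bernoulli ((a + b) * ½) x ^ℚ m)) * x
row-sum n m p d a b x n≡ = begin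
  sum1to n (λ s → ((½ ^ℚ m) * ℕ→ℚ (binom m s (suc p))) * g n s a b x)
    ≡⟨ sum1to-cong n _ _ (λ s _ _ → regroup s) ⟩
  sum1to n (λ s → ((½ ^ℚ m) * x) * binomialTerm A B m p n s)
    ≡⟨ sum1to-*ˡ n ((½ ^ℚ m) * x) (binomialTerm A B m p n) ⟩
  ((½ ^ℚ m) * x) * sum1to n (binomialTerm A B m p n)
    ≡⟨ cong (((½ ^ℚ m) * x) *_) (binomial-theorem-shifted A B m p d n n≡) ⟩
  ((½ ^ℚ m) * x) * (Aᵈ * Bᵖ * ((A + B) ^ℚ m))
    ≡⟨ solve 5 (λ h x u v w → (h :* x) :* (u :* v :* w) := (u :* v :* (w :* h)) :* x)
             refl (½ ^ℚ m) x Aᵈ Bᵖ ((A + B) ^ℚ m) ⟩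
  (Aᵈ * Bᵖ * (((A + B) ^ℚ m) * (½ ^ℚ m))) * x
    ≡⟨ cong (λ y → (Aᵈ * Bᵖ * y) * x) (sym (^ℚ-distribʳ-* (A + B) ½ m)) ⟩
  (Aᵈ * Bᵖ * (((A + B) * ½) ^ℚ m)) * x
    ≡⟨ cong (λ y → (Aᵈ * Bᵖ * (y ^ℚ m)) * x) (sym (bernoulli-midpoint a b x)) ⟩
  (Aᵈ * Bᵖ * (bernoulli ((a + b) * ½) x ^ℚ m)) * x
    ∎
  where
  A = bernoulli a x
  B = bernoulli b x
  Aᵈ = A ^ℚ d
  Bᵖ = B ^ℚ p
  regroup : ∀ s → ((½ ^ℚ m) * ℕ→ℚ (binom m s (suc p))) * g n s a b x
                ≡ ((½ ^ℚ m) * x) * binomialTerm A B m p n s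
  regroup s = solve 5 (λ h c u v x → (h :* c) :* ((u :* v) :* x) := (h :* x) :* (c :* (u :* v)))
                refl (½ ^ℚ m) (ℕ→ℚ (binom m s (suc p))) (A ^ℚ (n ∸ s)) (B ^ℚ (s ∸ 1)) x

halfLower halfUpper : Fin 2 → ℚ → ℚ → ℚ
halfLower zero       a b = a
halfLower (suc zero) a b = (a + b) * ½
halfUpper zero       a b = (a + b) * ½
halfUpper (suc zero) a b = b

row-step : ∀ n c r a b x → 1 ≤ r → r ≤ n →
  sum1to n (λ s → bsel n c r s * g n s a b x) ≡ g n r (halfLower c a b) (halfUpper c a b) x
row-step n zero (suc r) a b x _ 1+r≤n =
  trans (row-sum n r 0 (n ∸ suc r) a b x (sym (ℕ.m+[n∸m]≡n 1+r≤n)))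
        (cong (λ y → (y * (bernoulli ((a + b) * ½) x ^ℚ r)) * x) (*-identityʳ (bernoulli a x ^ℚ (n ∸ suc r))))
row-step n (suc zero) (suc r) a b x _ 1+r≤n =
  trans (row-sum n (n ∸ suc r) r 0 a b x (sym (trans (ℕ.+-identityʳ _) (ℕ.m+[n∸m]≡n 1+r≤n))))
        (cong (_* x) (trans (cong (_* Mᵏ) (*-identityˡ Bʳ)) (*-comm Bʳ Mᵏ)))
  where
  Bʳ = bernoulli b x ^ℚ r
  Mᵏ = bernoulli ((a + b) * ½) x ^ℚ (n ∸ suc r)

lowerEnd upperEnd : ∀ {k} → Vec (Fin 2) k → ℚ
lowerEnd {k} L = ℕ→ℚ (idx0 L) * (½ ^ℚ k)
upperEnd {k} L = ℕ→ℚ (index L) * (½ ^ℚ k)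

ℕ→ℚ-*-halve : ∀ t h → ℕ→ℚ t * h ≡ ℕ→ℚ (2 ℕ.* t) * (½ * h)
ℕ→ℚ-*-halve t h = begin
  ℕ→ℚ t * h                       ≡⟨ solve 2 (λ t h → t :* h := (t :+ t) :* (con ½ :* h)) refl (ℕ→ℚ t) h ⟩
  (ℕ→ℚ t + ℕ→ℚ t) * (½ * h)       ≡⟨ cong (_* (½ * h)) (sym (ℕ→ℚ-double t)) ⟩
  ℕ→ℚ (2 ℕ.* t) * (½ * h)         ∎

ℕ→ℚ-*-midpoint : ∀ t h → (ℕ→ℚ t * h + ℕ→ℚ (suc t) * h) * ½ ≡ ℕ→ℚ (suc (2 ℕ.* t)) * (½ * h)
ℕ→ℚ-*-midpoint t h = begin
  (ℕ→ℚ t * h + ℕ→ℚ (suc t) * h) * ½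
    ≡⟨ cong (λ u → (ℕ→ℚ t * h + u * h) * ½) (ℕ→ℚ-suc t) ⟩
  (ℕ→ℚ t * h + (1ℚ + ℕ→ℚ t) * h) * ½
    ≡⟨ solve 2 (λ t h → (t :* h :+ (con 1ℚ :+ t) :* h) :* con ½ := (con 1ℚ :+ (t :+ t)) :* (con ½ :* h))
             refl (ℕ→ℚ t) h ⟩
  (1ℚ + (ℕ→ℚ t + ℕ→ℚ t)) * (½ * h)
    ≡⟨ cong (λ u → (1ℚ + u) * (½ * h)) (sym (ℕ→ℚ-double t)) ⟩
  (1ℚ + ℕ→ℚ (2 ℕ.* t)) * (½ * h)
    ≡⟨ cong (_* (½ * h)) (sym (ℕ→ℚ-suc (2 ℕ.* t))) ⟩
  ℕ→ℚ (suc (2 ℕ.* t)) * (½ * h)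
    ∎

lowerEnd-∷ : ∀ c {k} (L : Vec (Fin 2) k) → lowerEnd (c ∷ L) ≡ halfLower c (lowerEnd L) (upperEnd L)
lowerEnd-∷ zero       {k} L = sym (ℕ→ℚ-*-halve (idx0 L) (½ ^ℚ k))
lowerEnd-∷ (suc zero) {k} L = sym (ℕ→ℚ-*-midpoint (idx0 L) (½ ^ℚ k))

upperEnd-∷ : ∀ c {k} (L : Vec (Fin 2) k) → upperEnd (c ∷ L) ≡ halfUpper c (lowerEnd L) (upperEnd L)
upperEnd-∷ zero       {k} L = sym (ℕ→ℚ-*-midpoint (idx0 L) (½ ^ℚ k))
upperEnd-∷ (suc zero) {k} L =
  trans (cong (λ u → ℕ→ℚ u * (½ * (½ ^ℚ k))) (sym (ℕ.*-suc 2 (idx0 L))))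
        (sym (ℕ→ℚ-*-halve (index L) (½ ^ℚ k)))

row-step-dyadic : ∀ n c r {k} (L : Vec (Fin 2) k) x → 1 ≤ r → r ≤ n →
  sum1to n (λ s → bsel n c r s * g n s (lowerEnd L) (upperEnd L) x) ≡ g n r (lowerEnd (c ∷ L)) (upperEnd (c ∷ L)) x
row-step-dyadic n c r L x 1≤r r≤n =
  trans (row-step n c r (lowerEnd L) (upperEnd L) x 1≤r r≤n)
        (sym (cong₂ (λ a b → g n r a b x) (lowerEnd-∷ c L) (upperEnd-∷ c L)))

F-∷ : ∀ n r c d {k} (L : Vec (Fin 2) k) x → F n r (c ∷ d ∷ L) x ≡ sum1to n (λ s → bsel n c r s * F n s (d ∷ L) x)
F-∷ n r c d L x = begin
  sum1to n (λ j → sum1to n (λ s → b s * P s j) * (x ^ℚ j))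
    ≡⟨ sum1to-cong n _ _ (λ j _ _ → sym (sum1to-*ʳ n (x ^ℚ j) (λ s → b s * P s j))) ⟩
  sum1to n (λ j → sum1to n (λ s → (b s * P s j) * (x ^ℚ j)))
    ≡⟨ sum1to-comm n n (λ s j → (b s * P s j) * (x ^ℚ j)) ⟩
  sum1to n (λ s → sum1to n (λ j → (b s * P s j) * (x ^ℚ j)))
    ≡⟨ sum1to-cong n _ _ (λ s _ _ → factor s) ⟩
  sum1to n (λ s → b s * F n s (d ∷ L) x)
    ∎
  where
  b : ℕ → ℚ
  b = bsel n c r
  P : ℕ → ℕ → ℚ
  P = chain n (d ∷ L)
  factor : ∀ s → sum1to n (λ j → (b s * P s j) * (x ^ℚ j)) ≡ b s * F n s (d ∷ L) x
  factor s = trans (sum1to-cong n _ _ (λ j _ _ → *-assoc (b s) (P s j) (x ^ℚ j)))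
                   (sum1to-*ˡ n (b s) (λ j → P s j * (x ^ℚ j)))

F≡g-dyadic : ∀ n r {k} (L : Vec (Fin 2) (suc k)) x → 1 ≤ r → r ≤ n →
  F n r L x ≡ g n r (lowerEnd L) (upperEnd L) x
F≡g-dyadic n r (c ∷ []) x 1≤r r≤n =
  trans (sum1to-cong n _ _ (λ j 1≤j _ → cong (bsel n c r j *_) (^ℚ≡g[0,1] n j x 1≤j)))
        (row-step-dyadic n c r [] x 1≤r r≤n)
F≡g-dyadic n r (c ∷ d ∷ L) x 1≤r r≤n = begin
  F n r (c ∷ d ∷ L) x
    ≡⟨ F-∷ n r c d L x ⟩
  sum1to n (λ s → bsel n c r s * F n s (d ∷ L) x)
    ≡⟨ sum1to-cong n _ _ (λ s 1≤s s≤n → cong (bsel n c r s *_) (F≡g-dyadic n s (d ∷ L) x 1≤s s≤n)) ⟩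
  sum1to n (λ s → bsel n c r s * g n s (lowerEnd (d ∷ L)) (upperEnd (d ∷ L)) x)
    ≡⟨ row-step-dyadic n c r (d ∷ L) x 1≤r r≤n ⟩
  g n r (lowerEnd (c ∷ d ∷ L)) (upperEnd (c ∷ d ∷ L)) x
    ∎

theorem2 : (n i m : ℕ) → 1 ≤ n → 1 ≤ i → i ≤ n →
    (L : Vec (Fin 2) (suc m)) → (x : ℚ) →
    F n i L x ≡ g n i (ℕ→ℚ (index L ∸ 1) * (½ ^ℚ suc m)) (ℕ→ℚ (index L) * (½ ^ℚ suc m)) x
theorem2 n i m _ 1≤i i≤n L x = F≡g-dyadic n i L x 1≤i i≤n
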